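{- For all $(\lambda^{(1)}|\cdots|\lambda^{(r)})\in\mathrm{Par}^r$, $$\mathcal{S}_{(\lambda^{(1)}|\cdots|\lambda^{(r)})}=m_{(\lambda^{(1)}|\cdots|\lambda^{(r)})}+\sum_{(\mu^{(1)}|\cdots|\mu^{(r)})\prec(\lambda^{(1)}|\cdots|\lambda^{(r)})}K^{(\lambda^{(1)}|\cdots|\lambda^{(r)})}_{(\mu^{(1)}|\cdots|\mu^{(r)})}\,m_{(\mu^{(1)}|\cdots|\mu^{(r)})}.$$
   Context: Key polynomials $\mathcal{K}_\alpha$: unique polynomials with $\mathcal{K}_\alpha=x^\alpha$ if $\alpha$ weakly decreasing and $\mathcal{K}_{s_i\alpha}=\xi_i\mathcal{K}_\alpha$ whenever $\alpha_i>\alpha_{i+1}$, $\xi_if=\frac{x_if-x_{i+1}s_if}{x_i-x_{i+1}}$. $\mathrm{rev}(\lambda)=(\lambda_{\ell(\lambda)},\dots,\lambda_1)$, $*$ concatenation, $0^m$ $m$ zeros. $\mathcal{S}_{(\lambda)}(X_1|\cdots|X_r)\in\Lambda(X_1)\otimes\cdots\otimes\Lambda(X_r)$ is the coefficientwise limit as $n_i\to\infty$ of $\mathcal{K}_\gamma(x_{1,1},\dots,x_{r,n_r})$, $\gamma=(0^{n_1-\ell(\lambda^{(1)})}*\mathrm{rev}(\lambda^{(1)}))*\cdots*(0^{n_r-\ell(\lambda^{(r)})}*\mathrm{rev}(\lambda^{(r)}))$. $m_{(\mu)}=m_{\mu^{(1)}}(X_1)\cdots m_{\mu^{(r)}}(X_r)$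 and $K^{(\lambda)}_{(\mu)}$ are the coefficients of $\mathcal{S}_{(\lambda)}$ in this basis. Lexicographic order on partitions (padded with zeros): $\mu<_L\lambda$ if for some $k$, $\mu_i=\lambda_i$ for $i<k$ and $\mu_k<\lambda_k$. On $\mathrm{Par}^r$: $(\mu)\prec(\lambda)$ if there is $1\le k\le r$ with $\mu^{(i)}=\lambda^{(i)}$ for all $i>k$ and $\mu^{(k)}<_L\lambda^{(k)}$. -}

module Defs where

open import Data.Nat as ℕ using (ℕ; zero; suc; _<_; _≥_; _≤_)
open import Data.Integer as ℤ using (ℤ; 0ℤ; 1ℤ; _-_)
open import Data.Fin using (Fin; zero; suc; inject₁; _<_)
open import Data.List using (List; []; _∷_)
open import Data.List.Relation.Unary.All using (All)
open import Data.List.Relation.Unary.Linked using (Linked)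
open import Data.Vec as Vec using (Vec; []; _∷_; lookup; _[_]≔_; _++_; reverse; toList)
open import Data.Vec.Properties using (≡-dec)
open import Data.Product using (Σ; ∃; _×_; _,_; proj₁)
open import Data.Sum using (_⊎_)
open import Data.Empty using (⊥)
open import Relation.Nullary using (¬_; yes; no)
open import Relation.Binary.PropositionalEquality using (_≡_)

-- Formal power series / polynomials in n variables with ℤ coefficients,
-- represented by their coefficient function on exponent vectors.

Poly : ℕ → Set
Poly n = Vec ℕ n → ℤ

monomial : ∀ {n} → Vec ℕ n → Poly n
monomial α a with ≡-dec ℕ._≟_ a α
... | yes _ = 1ℤ
... | no _  = 0ℤ

mulX : ∀ {n} → Fin n → Poly n → Poly n
mulX i f a with lookup a i
... | zero  = 0ℤ
... | suc k = f (a [ i ]≔ k)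

_⊖_ : ∀ {n} → Poly n → Poly n → Poly n
(f ⊖ g) a = f a - g a

swapAdj : ∀ {m} {A : Set} → Fin m → Vec A (suc m) → Vec A (suc m)
swapAdj i a = (a [ inject₁ i ]≔ lookup a (suc i)) [ suc i ]≔ lookup a (inject₁ i)

sAct : ∀ {m} → Fin m → Poly (suc m) → Poly (suc m)
sAct i f a = f (swapAdj i a)

WeaklyDecreasing : ∀ {n} → Vec ℕ n → Set
WeaklyDecreasing α = Linked _≥_ (toList α)

KeyFamily : Set
KeyFamily = ∀ {n} → Vec ℕ n → Poly n

-- The relation
-- K_{s_i α} = ξ_i K_α, with ξ_i f = (x_i f - x_{i+1} s_i f)/(x_i - x_{i+1}),
-- is expressed (in the integral domain ℤ[[x]]) as
-- (x_i - x_{i+1}) K_{s_i α} = x_i K_α - x_{i+1} s_i K_α.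
-- Positions i, i+1 are inject₁ i, suc i.
record IsKeyFamily (K : KeyFamily) : Set where
  field
    key-dominant : ∀ {n} (α : Vec ℕ n) → WeaklyDecreasing α →
                   ∀ a → K α a ≡ monomial α a
    key-step : ∀ {m} (α : Vec ℕ (suc m)) (i : Fin m) →
               lookup α (suc i) ℕ.< lookup α (inject₁ i) →
               ∀ a → (mulX (inject₁ i) (K (swapAdj i α)) ⊖ mulX (suc i) (K (swapAdj i α))) a
                     ≡ (mulX (inject₁ i) (K α) ⊖ mulX (suc i) (sAct i (K α))) a

IsPartition : List ℕ → Set
IsPartition xs = Linked _≥_ xs × All (0 ℕ.<_) xs

Partition : Set
Partition = Σ (List ℕ) IsPartition

parts : Partition → List ℕ
parts = proj₁

_<L_ : List ℕ → List ℕ → Set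
[] <L [] = ⊥
[] <L (y ∷ ys) = 0 ℕ.< y ⊎ (0 ≡ y × [] <L ys)
(x ∷ xs) <L [] = x ℕ.< 0 ⊎ (x ≡ 0 × xs <L [])
(x ∷ xs) <L (y ∷ ys) = x ℕ.< y ⊎ (x ≡ y × xs <L ys)

_≺_ : ∀ {r} → Vec Partition r → Vec Partition r → Set
_≺_ {r} μs λs = ∃ λ (k : Fin r) →
  (∀ (i : Fin r) → k Data.Fin.< i → parts (lookup μs i) ≡ parts (lookup λs i))
  × (parts (lookup μs k) <L parts (lookup λs k))

SameParts : ∀ {r} → Vec Partition r → Vec Partition r → Set
SameParts μs λs = ∀ i → parts (lookup μs i) ≡ parts (lookup λs i)

-- pad (or truncate) a list to length n with zeros on the right
padTo : (n : ℕ) → List ℕ → Vec ℕ n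
padTo zero _ = []
padTo (suc n) [] = 0 ∷ padTo n []
padTo (suc n) (x ∷ xs) = x ∷ padTo n xs

concatB : ∀ {r} (ns : Vec ℕ r) → ((i : Fin r) → Vec ℕ (lookup ns i)) → Vec ℕ (Vec.sum ns)
concatB [] f = []
concatB (n ∷ ns) f = f zero ++ concatB ns (λ i → f (suc i))

-- γ = (0^{n_1-ℓ} * rev λ^(1)) * ... * (0^{n_r-ℓ} * rev λ^(r))  (for n_i ≥ ℓ(λ^(i)))
gammaVec : ∀ {r} (ns : Vec ℕ r) → Vec Partition r → Vec ℕ (Vec.sum ns)
gammaVec ns λs = concatB ns (λ i → reverse (padTo (lookup ns i) (parts (lookup λs i))))

-- exponent vector of the leading monomial x_{1,1}^{μ^(1)_1} x_{1,2}^{μ^(1)_2} ... of m_(μ)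
muVec : ∀ {r} (ns : Vec ℕ r) → Vec Partition r → Vec ℕ (Vec.sum ns)
muVec ns μs = concatB ns (λ i → padTo (lookup ns i) (parts (lookup μs i)))

{-# OPTIONS --safe #-}
-- Write x ⊴ y when Σ_{j ≥ k} (x_j ∸ v) ≤ Σ_{j ≥ k} (y_j ∸ v) for all k and v.  Comparing
-- coefficients in (x_i − x_{i+1}) K_{s_i β} = x_i K_β − x_{i+1} s_i K_β along a line on which
-- x_i + x_{i+1} is constant expresses a coefficient of K_{s_i β} at c through coefficients of
-- K_β at the points of that line whose pair (x_i, x_{i+1}) is at least as spread out as
-- (c_i, c_{i+1}); if these vanish except at the point with x_i = c_i ⊔ c_{i+1}, it equals the
-- coefficient there.  Swapping the last ascent and inducting on Σ_j j α_j then shows that K_α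
-- has coefficient 1 at α and support ⊴ α.
--
-- gammaVec ns λs is the blockwise reversal of the blockwise decreasing vector δ = muVec ns λs.
-- Sorting it within blocks by the same swaps keeps the coefficient at δ (the other points of each
-- line have larger excess than δ), so that coefficient is 1.  A nonzero coefficient at
-- muVec ns μs gives muVec ns μs ⊴ gammaVec ns λs, and reading this off block by block from the
-- last block forces μs = λs or μs ≺ λs.  N only has to prevent padding from truncating a part.
module Submission where

open import Defs
open import Data.Bool using (Bool; true; false; _∨_)
import Data.Bool.Properties as Bool
open import Data.Fin using (Fin; zero; suc; inject₁; toℕ; fromℕ<)
open import Data.Fin.Properties using (toℕ-inject₁; toℕ-fromℕ<)
open import Data.Integer as ℤ using (ℤ; 0ℤ; 1ℤ) renaming (_+_ to _+ℤ_; _-_ to _-ℤ_)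
import Data.Integer.Properties as ℤₚ
import Data.Integer.Tactic.RingSolver as ℤ-Ring
open import Data.List as List using (List; []; _∷_; length)
open import Data.List.Relation.Unary.All as All using (All; []; _∷_)
open import Data.List.Relation.Unary.Linked as Linked using (Linked; []; [-]; _∷_)
open import Data.List.Relation.Unary.Linked.Properties using (Linked⇒All)
open import Data.Nat as ℕ using (ℕ; zero; suc; _+_; _∸_; _≤_; _<_; _≥_; _⊔_; z≤n; s≤s; _≤?_; _<?_; _≡ᵇ_)
open import Data.Nat.Induction using (<-wellFounded)
open import Data.Nat.ListAction using (sum)
open import Data.Nat.Properties
import Data.Nat.Tactic.RingSolver as ℕ-Ring
open import Data.Product using (∃; _×_; _,_; proj₁; proj₂)
open import Data.Sum using (_⊎_; inj₁; inj₂)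
open import Data.Vec as Vec using (Vec; []; _∷_; lookup; _[_]≔_; _++_; reverse; _∷ʳ_)
open import Data.Vec.Properties using (≡-dec; reverse-∷)
open import Function using (_∘_)
open import Induction.WellFounded using (Acc; acc)
open import Relation.Binary.Definitions using (tri<; tri≈; tri>)
open import Relation.Binary.PropositionalEquality
open import Relation.Nullary using (¬_; Dec; yes; no; contradiction)
open import Relation.Nullary.Decidable using (_×-dec_; _⊎-dec_; ¬?; decidable-stable)

-- Reading beyond the end gives 0, and the pair operations at i leave a vector
-- unchanged unless i + 1 is a position.
at : ∀ {n} → Vec ℕ n → ℕ → ℕ
at [] _ = 0
at (x ∷ xs) zero = x
at (x ∷ xs) (suc k) = at xs k

setPair : ∀ {n} → ℕ → Vec ℕ n → ℕ → ℕ → Vec ℕ n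
setPair zero (x ∷ y ∷ xs) u z = u ∷ z ∷ xs
setPair (suc i) (x ∷ xs) u z = x ∷ setPair i xs u z
setPair _ xs u z = xs

swapAt : ∀ {n} → ℕ → Vec ℕ n → Vec ℕ n
swapAt i xs = setPair i xs (at xs (suc i)) (at xs i)

rebalance : ∀ {n} → ℕ → Vec ℕ n → ℕ → Vec ℕ n
rebalance i c w = setPair i c w ((at c i + at c (suc i)) ∸ w)

setPair-setPair : ∀ {n} i (c : Vec ℕ n) u z u′ z′ → setPair i (setPair i c u z) u′ z′ ≡ setPair i c u′ z′
setPair-setPair zero [] u z u′ z′ = refl
setPair-setPair zero (x ∷ []) u z u′ z′ = refl
setPair-setPair zero (x ∷ y ∷ c) u z u′ z′ = refl
setPair-setPair (suc i) [] u z u′ z′ = refl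
setPair-setPair (suc i) (x ∷ c) u z u′ z′ = cong (x ∷_) (setPair-setPair i c u z u′ z′)

setPair-at : ∀ {n} i (c : Vec ℕ n) → setPair i c (at c i) (at c (suc i)) ≡ c
setPair-at zero [] = refl
setPair-at zero (x ∷ []) = refl
setPair-at zero (x ∷ y ∷ c) = refl
setPair-at (suc i) [] = refl
setPair-at (suc i) (x ∷ c) = cong (x ∷_) (setPair-at i c)

at-setPair₁ : ∀ {n} i (c : Vec ℕ n) u z → suc i < n → at (setPair i c u z) i ≡ u
at-setPair₁ zero (x ∷ []) u z (s≤s ())
at-setPair₁ zero (x ∷ y ∷ c) u z _ = refl
at-setPair₁ (suc i) (x ∷ c) u z (s≤s p) = at-setPair₁ i c u z p

at-setPair₂ : ∀ {n} i (c : Vec ℕ n) u z → suc i < n → at (setPair i c u z) (suc i) ≡ z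
at-setPair₂ zero (x ∷ []) u z (s≤s ())
at-setPair₂ zero (x ∷ y ∷ c) u z _ = refl
at-setPair₂ (suc i) (x ∷ c) u z (s≤s p) = at-setPair₂ i c u z p

at-setPair-other : ∀ {n} i (c : Vec ℕ n) u z j → j ≢ i → j ≢ suc i → at (setPair i c u z) j ≡ at c j
at-setPair-other zero [] u z j p q = refl
at-setPair-other zero (x ∷ []) u z j p q = refl
at-setPair-other zero (x ∷ y ∷ c) u z zero p q = contradiction refl p
at-setPair-other zero (x ∷ y ∷ c) u z (suc zero) p q = contradiction refl q
at-setPair-other zero (x ∷ y ∷ c) u z (suc (suc j)) p q = refl
at-setPair-other (suc i) [] u z j p q = refl
at-setPair-other (suc i) (x ∷ c) u z zero p q = refl
at-setPair-other (suc i) (x ∷ c) u z (suc j) p q =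
  at-setPair-other i c u z j (p ∘ cong suc) (q ∘ cong suc)

swapAt-involutive : ∀ {n} i (c : Vec ℕ n) → swapAt i (swapAt i c) ≡ c
swapAt-involutive zero [] = refl
swapAt-involutive zero (x ∷ []) = refl
swapAt-involutive zero (x ∷ y ∷ c) = refl
swapAt-involutive (suc i) [] = refl
swapAt-involutive (suc i) (x ∷ c) = cong (x ∷_) (swapAt-involutive i c)

rebalance-at : ∀ {n} i (c : Vec ℕ n) → rebalance i c (at c i) ≡ c
rebalance-at i c = trans (cong (setPair i c (at c i)) (m+n∸m≡n (at c i) _)) (setPair-at i c)

-- Excess and dominance

-- Bounding excess x k v by excess y k v for every v says that the suffix of x from k is
-- weakly submajorized by that of y; so x ⊴ y is dominance order, suffix by suffix.
excess : ∀ {n} → Vec ℕ n → ℕ → ℕ → ℕ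
excess [] k v = 0
excess (x ∷ xs) zero v = (x ∸ v) + excess xs zero v
excess (x ∷ xs) (suc k) v = excess xs k v

infix 4 _⊴_
record _⊴_ {n} (b α : Vec ℕ n) : Set where
  constructor dominated
  field excess-≤ : ∀ k v → excess b k v ≤ excess α k v
open _⊴_ public

excess-at : ∀ {n} (x : Vec ℕ n) k v → k < n → excess x k v ≡ (at x k ∸ v) + excess x (suc k) v
excess-at (x ∷ xs) zero v _ = refl
excess-at (x ∷ xs) (suc k) v (s≤s k<n) = excess-at xs k v k<n

excess-suc-≤ : ∀ {n} (x : Vec ℕ n) k v → excess x (suc k) v ≤ excess x k v
excess-suc-≤ [] k v = z≤n
excess-suc-≤ (x ∷ xs) zero v = m≤n+m _ _
excess-suc-≤ (x ∷ xs) (suc k) v = excess-suc-≤ xs k v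

excess-antitone : ∀ {n} (x : Vec ℕ n) {j k} v → j ≤ k → excess x k v ≤ excess x j v
excess-antitone x v (z≤n {k}) = go k
  where
  go : ∀ k → excess x k v ≤ excess x 0 v
  go zero = ≤-refl
  go (suc k) = ≤-trans (excess-suc-≤ x k v) (go k)
excess-antitone [] v (s≤s j≤k) = z≤n
excess-antitone (x ∷ xs) v (s≤s j≤k) = excess-antitone xs v j≤k

at-∸-≤-excess : ∀ {n} (x : Vec ℕ n) {k j} v → k ≤ j → at x j ∸ v ≤ excess x k v
at-∸-≤-excess [] {j = j} v _ = ≤-reflexive (0∸n≡0 v)
at-∸-≤-excess (x ∷ xs) {j = zero} v z≤n = m≤m+n _ _
at-∸-≤-excess (x ∷ xs) {j = suc j} v z≤n = ≤-trans (at-∸-≤-excess xs v z≤n) (m≤n+m _ _)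
at-∸-≤-excess (x ∷ xs) v (s≤s k≤j) = at-∸-≤-excess xs v k≤j

excess-length : ∀ {n} (x : Vec ℕ n) v → excess x n v ≡ 0
excess-length [] v = refl
excess-length (x ∷ xs) v = excess-length xs v

excess-setPair-lo : ∀ {n} i (x : Vec ℕ n) u z {k} v → k ≤ i → suc i < n →
  excess (setPair i x u z) k v + ((at x i ∸ v) + (at x (suc i) ∸ v)) ≡ excess x k v + ((u ∸ v) + (z ∸ v))
excess-setPair-lo zero (x ∷ []) u z v _ (s≤s ())
excess-setPair-lo zero (x ∷ y ∷ xs) u z v z≤n _ = rearrange (u ∸ v) (z ∸ v) (x ∸ v) (y ∸ v) (excess xs zero v)
  where
  rearrange : ∀ a b c d e → (a + (b + e)) + (c + d) ≡ (c + (d + e)) + (a + b)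
  rearrange = ℕ-Ring.solve-∀
excess-setPair-lo (suc i) (x ∷ xs) u z v z≤n (s≤s i<n) =
  trans (+-assoc (x ∸ v) _ _) (trans (cong ((x ∸ v) +_) (excess-setPair-lo i xs u z v z≤n i<n)) (sym (+-assoc (x ∸ v) _ _)))
excess-setPair-lo (suc i) (x ∷ xs) u z v (s≤s k≤i) (s≤s i<n) = excess-setPair-lo i xs u z v k≤i i<n

excess-setPair-hi : ∀ {n} i (x : Vec ℕ n) u z {k} v → suc (suc i) ≤ k → excess (setPair i x u z) k v ≡ excess x k v
excess-setPair-hi zero [] u z v _ = refl
excess-setPair-hi zero (x ∷ []) u z v _ = refl
excess-setPair-hi zero (x ∷ y ∷ xs) u z v (s≤s (s≤s _)) = refl
excess-setPair-hi (suc i) [] u z v _ = refl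
excess-setPair-hi (suc i) (x ∷ xs) u z v (s≤s k≥i) = excess-setPair-hi i xs u z v k≥i

excess-swapAt-lo : ∀ {n} i (x : Vec ℕ n) {k} v → k ≤ i → suc i < n → excess (swapAt i x) k v ≡ excess x k v
excess-swapAt-lo i x {k} v k≤i i<n = +-cancelʳ-≡ _ _ _
  (trans (excess-setPair-lo i x _ _ v k≤i i<n) (cong (excess x k v +_) (+-comm (at x (suc i) ∸ v) _)))

excess-swapAt-hi : ∀ {n} i (x : Vec ℕ n) {k} v → suc (suc i) ≤ k → excess (swapAt i x) k v ≡ excess x k v
excess-swapAt-hi i x = excess-setPair-hi i x _ _

excess≡0 : ∀ {n} (x : Vec ℕ n) {k} v → (∀ j → k ≤ j → at x j ≤ v) → excess x k v ≡ 0
excess≡0 [] v _ = refl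
excess≡0 (x ∷ xs) {zero} v bound = cong₂ _+_ (m≤n⇒m∸n≡0 (bound 0 z≤n)) (excess≡0 xs v λ j _ → bound (suc j) z≤n)
excess≡0 (x ∷ xs) {suc k} v bound = excess≡0 xs v λ j k≤j → bound (suc j) (s≤s k≤j)

⊴-bounded : ∀ {n} {b α : Vec ℕ n} {k v} → b ⊴ α → (∀ j → k ≤ j → at α j ≤ v) → ∀ j → k ≤ j → at b j ≤ v
⊴-bounded {b = b} {α} {k} {v} b⊴α bound j k≤j = m∸n≡0⇒m≤n (n≤0⇒n≡0 (begin
  at b j ∸ v     ≤⟨ at-∸-≤-excess b v k≤j ⟩
  excess b k v   ≤⟨ excess-≤ b⊴α k v ⟩
  excess α k v   ≡⟨ excess≡0 α v bound ⟩
  0              ∎))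
  where open ≤-Reasoning

⊴-refl : ∀ {n} (α : Vec ℕ n) → α ⊴ α
⊴-refl α = dominated λ k v → ≤-refl

-- Spreading a pair of entries

-- w ∉ [a ⊓ b, a ⊔ b): the pair (w, a + b ∸ w) is at least as spread out as (a, b)
Outside : ℕ → ℕ → ℕ → Set
Outside a b w = (a ≤ w × b ≤ w) ⊎ (w < a × w < b)

outside? : ∀ a b w → Dec (Outside a b w)
outside? a b w = (a ≤? w ×-dec b ≤? w) ⊎-dec (w <? a ×-dec w <? b)

outside-sym : ∀ {a b w} → Outside a b w → Outside b a w
outside-sym (inj₁ (a≤w , b≤w)) = inj₁ (b≤w , a≤w)
outside-sym (inj₂ (w<a , w<b)) = inj₂ (w<b , w<a)

outside-⊔ : ∀ a b → Outside a b (a ⊔ b)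
outside-⊔ a b = inj₁ (m≤m⊔n a b , m≤n⊔m a b)

∸-pair-convex : ∀ {a b M m} v → m ≤ a → m ≤ b → a + b ≡ M + m → (a ∸ v) + (b ∸ v) ≤ (M ∸ v) + (m ∸ v)
∸-pair-convex {a} {b} {M} {m} v m≤a m≤b a+b≡M+m with ≤-total v m
... | inj₁ v≤m = ≤-reflexive (+-cancelʳ-≡ (v + v) _ _ (begin
      (a ∸ v) + (b ∸ v) + (v + v)  ≡⟨ shuffle (a ∸ v) (b ∸ v) v ⟩
      (a ∸ v + v) + (b ∸ v + v)    ≡⟨ cong₂ _+_ (m∸n+n≡m (≤-trans v≤m m≤a)) (m∸n+n≡m (≤-trans v≤m m≤b)) ⟩
      a + b                        ≡⟨ a+b≡M+m ⟩
      M + m                        ≡⟨ sym (cong₂ _+_ (m∸n+n≡m (≤-trans v≤m m≤M)) (m∸n+n≡m v≤m)) ⟩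
      (M ∸ v + v) + (m ∸ v + v)    ≡⟨ sym (shuffle (M ∸ v) (m ∸ v) v) ⟩
      (M ∸ v) + (m ∸ v) + (v + v)  ∎))
  where
  open ≡-Reasoning
  shuffle : ∀ p q r → p + q + (r + r) ≡ (p + r) + (q + r)
  shuffle = ℕ-Ring.solve-∀
  m≤M : m ≤ M
  m≤M = +-cancelʳ-≤ m m M (subst (m + m ≤_) a+b≡M+m (+-mono-≤ m≤a m≤b))
... | inj₂ m≤v = ≤-trans below-M (m≤m+n (M ∸ v) (m ∸ v))
  where
  a≤M : a ≤ M
  a≤M = +-cancelʳ-≤ m a M (≤-trans (+-monoʳ-≤ a m≤b) (≤-reflexive a+b≡M+m))
  b≤M : b ≤ M
  b≤M = +-cancelʳ-≤ m b M (≤-trans (+-monoʳ-≤ b m≤a) (≤-reflexive (trans (+-comm b a) a+b≡M+m)))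
  below-M : (a ∸ v) + (b ∸ v) ≤ M ∸ v
  below-M with ≤-total a v | ≤-total b v
  ... | inj₁ a≤v | _ = subst (_≤ M ∸ v) (sym (cong (_+ (b ∸ v)) (m≤n⇒m∸n≡0 a≤v))) (∸-monoˡ-≤ v b≤M)
  ... | inj₂ _ | inj₁ b≤v =
    subst (_≤ M ∸ v) (sym (trans (cong ((a ∸ v) +_) (m≤n⇒m∸n≡0 b≤v)) (+-identityʳ _))) (∸-monoˡ-≤ v a≤M)
  ... | inj₂ v≤a | inj₂ v≤b = m+n≤o⇒m≤o∸n _ (+-cancelʳ-≤ v _ _ (begin
      (a ∸ v) + (b ∸ v) + v + v    ≡⟨ shuffle (a ∸ v) (b ∸ v) v ⟩
      (a ∸ v + v) + (b ∸ v + v)    ≡⟨ cong₂ _+_ (m∸n+n≡m v≤a) (m∸n+n≡m v≤b) ⟩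
      a + b                        ≡⟨ a+b≡M+m ⟩
      M + m                        ≤⟨ +-monoʳ-≤ M m≤v ⟩
      M + v                        ∎))
    where
    open ≤-Reasoning
    shuffle : ∀ p q r → p + q + r + r ≡ (p + r) + (q + r)
    shuffle = ℕ-Ring.solve-∀

sum∸-≤ˡ : ∀ {a b w} → b ≤ w → a + b ∸ w ≤ a
sum∸-≤ˡ {a} {b} b≤w = ≤-trans (∸-monoʳ-≤ (a + b) b≤w) (≤-reflexive (m+n∸n≡m a b))

sum∸-≤ʳ : ∀ {a b w} → a ≤ w → a + b ∸ w ≤ b
sum∸-≤ʳ {a} {b} a≤w = ≤-trans (∸-monoʳ-≤ (a + b) a≤w) (≤-reflexive (m+n∸m≡n a b))

outside-spread : ∀ {a b w} v → Outside a b w → w ≤ a + b → (a ∸ v) + (b ∸ v) ≤ (w ∸ v) + ((a + b ∸ w) ∸ v)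
outside-spread v (inj₁ (a≤w , b≤w)) w≤s =
  ∸-pair-convex v (sum∸-≤ˡ b≤w) (sum∸-≤ʳ a≤w) (sym (m+[n∸m]≡n w≤s))
outside-spread {w = w} v (inj₂ (w<a , w<b)) w≤s = ≤-trans
  (∸-pair-convex v (<⇒≤ w<a) (<⇒≤ w<b) (sym (m∸n+n≡m w≤s))) (≤-reflexive (+-comm _ (w ∸ v)))

outside-spread-> : ∀ {a b w} → Outside a b w → w ≢ a → 0 < (w ∸ a) + ((a + b ∸ w) ∸ a)
outside-spread-> (inj₁ (a≤w , _)) w≢a = <-≤-trans (m<n⇒0<n∸m (≤∧≢⇒< a≤w (w≢a ∘ sym))) (m≤m+n _ _)
outside-spread-> {a} {b} {w} (inj₂ (_ , w<b)) _ = <-≤-trans (m<n⇒0<n∸m a<a+b∸w) (m≤n+m _ _)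
  where
  a<a+b∸w : a < a + b ∸ w
  a<a+b∸w = subst (a <_) (sym (+-∸-assoc a (<⇒≤ w<b))) (m<m+n a (m<n⇒0<n∸m w<b))

outside-≤ : ∀ {a b w p} → Outside a b w → w ≤ p → a + b ∸ w ≤ p → a ≤ p × b ≤ p
outside-≤ {a} {b} {w} {p} out w≤p s∸w≤p =
  bound out w≤p s∸w≤p , bound (outside-sym out) w≤p (subst (λ t → t ∸ w ≤ p) (+-comm a b) s∸w≤p)
  where
  bound : ∀ {a b p} → Outside a b w → w ≤ p → a + b ∸ w ≤ p → a ≤ p
  bound (inj₁ (a≤w , _)) w≤p _ = ≤-trans a≤w w≤p
  bound {a} {b} (inj₂ (_ , w<b)) _ s∸w≤p =
    ≤-trans (subst (a ≤_) (sym (+-∸-assoc a (<⇒≤ w<b))) (m≤m+n a (b ∸ w))) s∸w≤p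

outside-≤-max : ∀ {a b w} → a ≤ b → Outside a b w → w ≤ b → a + b ∸ w ≤ b → w ≡ b
outside-≤-max _ (inj₁ (_ , b≤w)) w≤b _ = ≤-antisym w≤b b≤w
outside-≤-max {a} {b} {w} _ (inj₂ (w<a , _)) _ s∸w≤b = contradiction s∸w≤b (<⇒≱ b<s∸w)
  where
  b<s∸w : b < a + b ∸ w
  b<s∸w = subst (b <_) (trans (+-comm b _) (sym (+-∸-comm b (<⇒≤ w<a)))) (m<m+n b (m<n⇒0<n∸m w<a))

module _ {n} (i : ℕ) (c : Vec ℕ n) (i<n : suc i < n) {w : ℕ} (out : Outside (at c i) (at c (suc i)) w) where

  private
    a = at c i
    b = at c (suc i)

  excess-≤-rebalance : w ≤ a + b → ∀ {k} v → k ≤ i → excess c k v ≤ excess (rebalance i c w) k v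
  excess-≤-rebalance w≤s {k} v k≤i = +-cancelʳ-≤ _ _ _ (begin
    excess c k v + ((a ∸ v) + (b ∸ v))                        ≤⟨ +-monoʳ-≤ (excess c k v) (outside-spread v out w≤s) ⟩
    excess c k v + ((w ∸ v) + ((a + b ∸ w) ∸ v))              ≡⟨ excess-setPair-lo i c w (a + b ∸ w) v k≤i i<n ⟨
    excess (rebalance i c w) k v + ((a ∸ v) + (b ∸ v))        ∎)
    where open ≤-Reasoning

  excess-<-rebalance : w ≢ a → b ≤ a → excess c 0 a < excess (rebalance i c w) 0 a
  excess-<-rebalance w≢a b≤a = begin-strict
    excess c 0 a                                              ≡⟨ +-identityʳ _ ⟨
    excess c 0 a + 0                                          <⟨ +-monoʳ-< (excess c 0 a) (outside-spread-> out w≢a) ⟩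
    excess c 0 a + ((w ∸ a) + ((a + b ∸ w) ∸ a))              ≡⟨ excess-setPair-lo i c w (a + b ∸ w) a z≤n i<n ⟨
    excess (rebalance i c w) 0 a + ((a ∸ a) + (b ∸ a))        ≡⟨ cong (excess (rebalance i c w) 0 a +_)
                                                                       (cong₂ _+_ (n∸n≡0 a) (m≤n⇒m∸n≡0 b≤a)) ⟩
    excess (rebalance i c w) 0 a + 0                          ≡⟨ +-identityʳ _ ⟩
    excess (rebalance i c w) 0 a                              ∎
    where open ≤-Reasoning

-- Sorting by adjacent swaps

-- Σ_j j · x_j
moment : ∀ {n} → Vec ℕ n → ℕ
moment [] = 0
moment (x ∷ xs) = Vec.sum xs + moment xs

sum-swapAt : ∀ {n} i (x : Vec ℕ n) → Vec.sum (swapAt i x) ≡ Vec.sum x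
sum-swapAt zero [] = refl
sum-swapAt zero (x ∷ []) = refl
sum-swapAt zero (x ∷ y ∷ xs) = trans (sym (+-assoc y x _)) (trans (cong (_+ Vec.sum xs) (+-comm y x)) (+-assoc x y _))
sum-swapAt (suc i) [] = refl
sum-swapAt (suc i) (x ∷ xs) = cong (x +_) (sum-swapAt i xs)

moment-swapAt-< : ∀ {n} i (x : Vec ℕ n) → suc i < n → at x i < at x (suc i) → moment (swapAt i x) < moment x
moment-swapAt-< zero (x ∷ y ∷ xs) _ x<y = +-monoˡ-< (Vec.sum xs + moment xs) (+-monoˡ-< (Vec.sum xs) x<y)
moment-swapAt-< (suc i) (x ∷ xs) (s≤s i<n) asc =
  subst (λ t → t + moment (swapAt i xs) < Vec.sum xs + moment xs) (sym (sum-swapAt i xs))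
        (+-monoʳ-< (Vec.sum xs) (moment-swapAt-< i xs i<n asc))

LastAscent : ∀ {n} → Vec ℕ n → ℕ → Set
LastAscent {n} α i = suc i < n × at α i < at α (suc i) × (∀ k → suc i < k → at α k ≤ at α (suc i))

head-maximal : ∀ {n} y (ys : Vec ℕ n) → WeaklyDecreasing (y ∷ ys) → ∀ k → at (y ∷ ys) k ≤ y
head-maximal y [] _ zero = ≤-refl
head-maximal y [] _ (suc k) = z≤n
head-maximal y (z ∷ zs) _ zero = ≤-refl
head-maximal y (z ∷ zs) (y≥z ∷ dec) (suc k) = ≤-trans (head-maximal z zs dec k) y≥z

weaklyDecreasing⊎lastAscent : ∀ {n} (α : Vec ℕ n) → WeaklyDecreasing α ⊎ ∃ (LastAscent α)
weaklyDecreasing⊎lastAscent [] = inj₁ []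
weaklyDecreasing⊎lastAscent (x ∷ xs) with weaklyDecreasing⊎lastAscent xs
... | inj₂ (i , i<n , asc , after) = inj₂ (suc i , s≤s i<n , asc , λ { (suc k) (s≤s i<k) → after k i<k })
weaklyDecreasing⊎lastAscent (x ∷ []) | inj₁ _ = inj₁ [-]
weaklyDecreasing⊎lastAscent (x ∷ y ∷ ys) | inj₁ dec with y ≤? x
... | yes y≤x = inj₁ (y≤x ∷ dec)
... | no y≰x = inj₂ (0 , s≤s (s≤s z≤n) , ≰⇒> y≰x , λ { (suc k) (s≤s _) → head-maximal y ys dec k })

prefixSum : (ℕ → ℤ) → ℕ → ℤ
prefixSum f zero = 0ℤ
prefixSum f (suc n) = prefixSum f n +ℤ f n

prefixSum-vanishing : ∀ f {m n} → m ≤ n → (∀ w → m ≤ w → w < n → f w ≡ 0ℤ) → prefixSum f n ≡ prefixSum f m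
prefixSum-vanishing f {m} {n} m≤n zeros with m≤n⇒m<n∨m≡n m≤n
... | inj₂ refl = refl
... | inj₁ (s≤s {n = n′} m≤n′) = begin
  prefixSum f n′ +ℤ f n′  ≡⟨ cong (prefixSum f n′ +ℤ_) (zeros n′ m≤n′ ≤-refl) ⟩
  prefixSum f n′ +ℤ 0ℤ    ≡⟨ ℤₚ.+-identityʳ _ ⟩
  prefixSum f n′          ≡⟨ prefixSum-vanishing f m≤n′ (λ w m≤w w<n′ → zeros w m≤w (m<n⇒m<1+n w<n′)) ⟩
  prefixSum f m           ∎
  where open ≡-Reasoning

module _ (G L : ℕ → ℤ) (s : ℕ) (top : G s ≡ L s)
         (step : ∀ u d → suc (u + d) ≡ s → G u -ℤ G (suc u) ≡ L u -ℤ L d) where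

  telescope : ∀ u d → u + d ≡ s → G u ≡ prefixSum L (suc s) -ℤ (prefixSum L u +ℤ prefixSum L d)
  telescope u zero u+0≡s with trans (sym (+-identityʳ u)) u+0≡s
  ... | refl = trans top (lemma (L u) (prefixSum L u))
    where
    lemma : ∀ l p → l ≡ (p +ℤ l) -ℤ (p +ℤ 0ℤ)
    lemma = ℤ-Ring.solve-∀
  telescope u (suc d) u+[1+d]≡s = begin
    G u                                              ≡⟨ lemma₁ (G u) (G (suc u)) ⟩
    (G u -ℤ G (suc u)) +ℤ G (suc u)                   ≡⟨ cong₂ _+ℤ_ (step u d 1+u+d≡s) (telescope (suc u) d 1+u+d≡s) ⟩
    (L u -ℤ L d) +ℤ (T -ℤ ((S u +ℤ L u) +ℤ S d))      ≡⟨ lemma₂ (L u) (L d) T (S u) (S d) ⟩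
    T -ℤ (S u +ℤ (S d +ℤ L d))                        ∎
    where
    open ≡-Reasoning
    1+u+d≡s : suc (u + d) ≡ s
    1+u+d≡s = trans (sym (+-suc u d)) u+[1+d]≡s
    S = prefixSum L
    T = prefixSum L (suc s)
    lemma₁ : ∀ x y → x ≡ (x -ℤ y) +ℤ y
    lemma₁ = ℤ-Ring.solve-∀
    lemma₂ : ∀ lu ld t su sd → (lu -ℤ ld) +ℤ (t -ℤ ((su +ℤ lu) +ℤ sd)) ≡ t -ℤ (su +ℤ (sd +ℤ ld))
    lemma₂ = ℤ-Ring.solve-∀

prefixSum-pair : ∀ f {a b} → b ≤ a → (∀ w → w ≤ a + b → Outside a b w → w ≢ a → f w ≡ 0ℤ) →
                 prefixSum f (suc (a + b)) -ℤ (prefixSum f a +ℤ prefixSum f b) ≡ f a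
prefixSum-pair f {a} {b} b≤a zeros = begin
  S (suc (a + b)) -ℤ (S a +ℤ S b)     ≡⟨ cong₂ (λ p q → p -ℤ (S a +ℤ q)) upper lower ⟩
  (S a +ℤ f a) -ℤ (S a +ℤ 0ℤ)         ≡⟨ lemma (f a) (S a) ⟩
  f a                                 ∎
  where
  open ≡-Reasoning
  S = prefixSum f
  lemma : ∀ x p → (p +ℤ x) -ℤ (p +ℤ 0ℤ) ≡ x
  lemma = ℤ-Ring.solve-∀
  upper : S (suc (a + b)) ≡ S (suc a)
  upper = prefixSum-vanishing f (s≤s (m≤m+n a b)) λ w a<w w≤a+b →
    zeros w (≤-pred w≤a+b) (inj₁ (<⇒≤ a<w , ≤-trans b≤a (<⇒≤ a<w))) (>⇒≢ a<w)
  lower : S b ≡ 0ℤ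
  lower = prefixSum-vanishing f z≤n λ w _ w<b →
    zeros w (≤-trans (<⇒≤ w<b) (m≤n+m b a)) (inj₂ (<-≤-trans w<b b≤a , w<b)) (<⇒≢ (<-≤-trans w<b b≤a))

prefixSum-pair-⊔ : ∀ f a b → (∀ w → w ≤ a + b → Outside a b w → w ≢ a ⊔ b → f w ≡ 0ℤ) →
                   prefixSum f (suc (a + b)) -ℤ (prefixSum f a +ℤ prefixSum f b) ≡ f (a ⊔ b)
prefixSum-pair-⊔ f a b zeros with ≤-total b a
... | inj₁ b≤a rewrite m≥n⇒m⊔n≡m b≤a = prefixSum-pair f b≤a zeros
... | inj₂ a≤b rewrite m≤n⇒m⊔n≡n a≤b | +-comm a b | ℤₚ.+-comm (prefixSum f a) (prefixSum f b) =
  prefixSum-pair f a≤b λ w w≤b+a out → zeros w w≤b+a (outside-sym out)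

-- Blocks

-- isStart k ≡ true marks a block beginning at position k; position 0 always begins one
DecreasingOnBlocks : ∀ {n} → (ℕ → Bool) → Vec ℕ n → Set
DecreasingOnBlocks {n} isStart x = ∀ i → suc i < n → isStart (suc i) ≡ false → at x (suc i) ≤ at x i

AgreeOnBlocks : ∀ {n} → (ℕ → Bool) → Vec ℕ n → Vec ℕ n → Set
AgreeOnBlocks isStart x y = ∀ k → k ≡ 0 ⊎ isStart k ≡ true → ∀ v → excess x k v ≡ excess y k v

-- the position of the last entry of the first block of a vector of length suc m
firstBlockEnd : (ℕ → Bool) → ℕ → ℕ
firstBlockEnd isStart zero = 0
firstBlockEnd isStart (suc m) with isStart 1
... | true = 0
... | false = suc (firstBlockEnd (isStart ∘ suc) m)

firstBlockEnd-spec : ∀ isStart m → isStart (suc (firstBlockEnd isStart m)) ≡ true ⊎ firstBlockEnd isStart m ≡ m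
firstBlockEnd-spec isStart zero = inj₂ refl
firstBlockEnd-spec isStart (suc m) with isStart 1 in eq
... | true = inj₁ eq
... | false with firstBlockEnd-spec (isStart ∘ suc) m
...   | inj₁ e = inj₁ e
...   | inj₂ e = inj₂ (cong suc e)

excess-firstBlock : ∀ isStart m (x : Vec ℕ (suc m)) {v} → DecreasingOnBlocks isStart x → Vec.head x ≤ v →
                    excess x 0 v ≡ excess x (suc (firstBlockEnd isStart m)) v
excess-firstBlock isStart zero (y ∷ []) dec y≤v = cong (_+ 0) (m≤n⇒m∸n≡0 y≤v)
excess-firstBlock isStart (suc m) (y ∷ z ∷ x) {v} dec y≤v with isStart 1 in eq
... | true = cong (_+ excess (z ∷ x) 0 v) (m≤n⇒m∸n≡0 y≤v)
... | false = trans (cong (_+ excess (z ∷ x) 0 v) (m≤n⇒m∸n≡0 y≤v))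
                    (excess-firstBlock (isStart ∘ suc) m (z ∷ x) (λ i → dec (suc i) ∘ s≤s)
                                       (≤-trans (dec 0 (s≤s (s≤s z≤n)) eq) y≤v))

agreeOnBlocks-head-≤ : ∀ {m} isStart (x y : Vec ℕ m) x₀ y₀ → DecreasingOnBlocks isStart (x₀ ∷ x) →
                       AgreeOnBlocks isStart (x₀ ∷ x) (y₀ ∷ y) → y₀ ≤ x₀
agreeOnBlocks-head-≤ {m} isStart x y x₀ y₀ dec agree =
  m∸n≡0⇒m≤n (+-cancelʳ-≡ (excess y e x₀) _ _ (≤-antisym bound (m≤n+m _ _)))
  where
  e = firstBlockEnd isStart m
  agree-end : excess (x₀ ∷ x) (suc e) x₀ ≡ excess (y₀ ∷ y) (suc e) x₀
  agree-end with firstBlockEnd-spec isStart m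
  ... | inj₁ s = agree (suc e) (inj₂ s) x₀
  ... | inj₂ e≡m rewrite e≡m = trans (excess-length x x₀) (sym (excess-length y x₀))
  bound : (y₀ ∸ x₀) + excess y e x₀ ≤ 0 + excess y e x₀
  bound = begin
    (y₀ ∸ x₀) + excess y e x₀      ≤⟨ +-monoʳ-≤ (y₀ ∸ x₀) (excess-antitone y x₀ z≤n) ⟩
    excess (y₀ ∷ y) 0 x₀           ≡⟨ agree 0 (inj₁ refl) x₀ ⟨
    excess (x₀ ∷ x) 0 x₀           ≡⟨ excess-firstBlock isStart m (x₀ ∷ x) dec ≤-refl ⟩
    excess (x₀ ∷ x) (suc e) x₀     ≡⟨ agree-end ⟩
    excess y e x₀                  ∎
    where open ≤-Reasoning

agreeOnBlocks⇒≡ : ∀ {n} isStart (x y : Vec ℕ n) → DecreasingOnBlocks isStart x → DecreasingOnBlocks isStart y →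
                  AgreeOnBlocks isStart x y → x ≡ y
agreeOnBlocks⇒≡ isStart [] [] _ _ _ = refl
agreeOnBlocks⇒≡ isStart (x₀ ∷ x) (y₀ ∷ y) decx decy agree =
  cong₂ _∷_ x₀≡y₀ (agreeOnBlocks⇒≡ (isStart ∘ suc) x y (tail decx) (tail decy) agree-tail)
  where
  x₀≡y₀ : x₀ ≡ y₀
  x₀≡y₀ = ≤-antisym (agreeOnBlocks-head-≤ isStart y x y₀ x₀ decy (λ k s v → sym (agree k s v)))
                    (agreeOnBlocks-head-≤ isStart x y x₀ y₀ decx agree)
  tail : ∀ {z₀ z} → DecreasingOnBlocks isStart (z₀ ∷ z) → DecreasingOnBlocks (isStart ∘ suc) z
  tail dec i = dec (suc i) ∘ s≤s
  agree-tail : AgreeOnBlocks (isStart ∘ suc) x y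
  agree-tail zero _ v =
    +-cancelˡ-≡ (x₀ ∸ v) _ _ (trans (agree 0 (inj₁ refl) v) (cong (λ t → (t ∸ v) + excess y 0 v) (sym x₀≡y₀)))
  agree-tail (suc k) (inj₂ s) v = agree (suc (suc k)) (inj₂ s) v

shiftBy : ℕ → (ℕ → Bool) → ℕ → Bool
shiftBy zero p k = p k
shiftBy (suc n) p zero = false
shiftBy (suc n) p (suc k) = shiftBy n p k

decreasingOnBlocks⊎innerAscent : ∀ {n} isStart (w : Vec ℕ n) →
  DecreasingOnBlocks isStart w ⊎ ∃ λ i → suc i < n × isStart (suc i) ≡ false × at w i < at w (suc i)
decreasingOnBlocks⊎innerAscent {n} isStart w
  with anyUpTo? (λ i → (suc i <? n) ×-dec (isStart (suc i) Bool.≟ false) ×-dec (at w i <? at w (suc i))) n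
... | yes (i , _ , ascent) = inj₂ (i , ascent)
... | no none = inj₁ λ i i+1<n inner → ≮⇒≥ λ asc → none (i , <-trans (n<1+n i) i+1<n , i+1<n , inner , asc)

agreeOnBlocks-swapAt : ∀ {n} isStart (w δ : Vec ℕ n) i → suc i < n → isStart (suc i) ≡ false →
                       AgreeOnBlocks isStart w δ → AgreeOnBlocks isStart (swapAt i w) δ
agreeOnBlocks-swapAt isStart w δ i i+1<n inner agree k s v with <-cmp k (suc i)
... | tri< k<i+1 _ _ = trans (excess-swapAt-lo i w v (≤-pred k<i+1) i+1<n) (agree k s v)
... | tri> _ _ i+1<k = trans (excess-swapAt-hi i w v i+1<k) (agree k s v)
agreeOnBlocks-swapAt isStart w δ i i+1<n inner agree k (inj₂ s) v | tri≈ _ refl _ =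
  contradiction (trans (sym s) inner) λ ()

-- the block starts 0, n₁, n₁ + n₂, …, n₁ + ⋯ + n_r (the last one is the end of the vector)
blockStart : ∀ {r} → Vec ℕ r → ℕ → Bool
blockStart [] k = k ≡ᵇ 0
blockStart (n ∷ ns) k = (k ≡ᵇ 0) ∨ shiftBy n (blockStart ns) k

blockStart-zero : ∀ {r} (ns : Vec ℕ r) → blockStart ns 0 ≡ true
blockStart-zero [] = refl
blockStart-zero (n ∷ ns) = refl

blockStart-shift : ∀ {r} n (ns : Vec ℕ r) k → blockStart (n ∷ ns) (n + k) ≡ blockStart ns k
blockStart-shift zero ns zero = sym (blockStart-zero ns)
blockStart-shift zero ns (suc k) = refl
blockStart-shift (suc n) ns k = go n k
  where
  go : ∀ n k → shiftBy n (blockStart ns) (n + k) ≡ blockStart ns k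
  go zero k = refl
  go (suc n) k = go n k

blockStart-interior : ∀ {r} n (ns : Vec ℕ r) k → suc k < n → blockStart (n ∷ ns) (suc k) ≡ false
blockStart-interior n ns k = go n (suc k)
  where
  go : ∀ n k → k < n → shiftBy n (blockStart ns) k ≡ false
  go (suc n) zero _ = refl
  go (suc n) (suc k) (s≤s k<n) = go n k k<n

excess-++ : ∀ {n m} (x : Vec ℕ n) (y : Vec ℕ m) v → excess (x ++ y) 0 v ≡ excess x 0 v + excess y 0 v
excess-++ [] y v = refl
excess-++ (x₀ ∷ x) y v = trans (cong ((x₀ ∸ v) +_) (excess-++ x y v)) (sym (+-assoc (x₀ ∸ v) _ _))

excess-++ʳ : ∀ {n m} (x : Vec ℕ n) (y : Vec ℕ m) k v → excess (x ++ y) (n + k) v ≡ excess y k v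
excess-++ʳ [] y k v = refl
excess-++ʳ (x₀ ∷ x) y k v = excess-++ʳ x y k v

excess-∷ʳ : ∀ {n} (x : Vec ℕ n) a v → excess (x ∷ʳ a) 0 v ≡ excess x 0 v + (a ∸ v)
excess-∷ʳ [] a v = +-comm (a ∸ v) 0
excess-∷ʳ (x₀ ∷ x) a v = trans (cong ((x₀ ∸ v) +_) (excess-∷ʳ x a v)) (sym (+-assoc (x₀ ∸ v) _ _))

excess-reverse : ∀ {n} (x : Vec ℕ n) v → excess (reverse x) 0 v ≡ excess x 0 v
excess-reverse [] v = refl
excess-reverse (x₀ ∷ x) v = begin
  excess (reverse (x₀ ∷ x)) 0 v     ≡⟨ cong (λ t → excess t 0 v) (reverse-∷ x₀ x) ⟩
  excess (reverse x ∷ʳ x₀) 0 v      ≡⟨ excess-∷ʳ (reverse x) x₀ v ⟩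
  excess (reverse x) 0 v + (x₀ ∸ v) ≡⟨ cong (_+ (x₀ ∸ v)) (excess-reverse x v) ⟩
  excess x 0 v + (x₀ ∸ v)           ≡⟨ +-comm _ (x₀ ∸ v) ⟩
  excess (x₀ ∷ x) 0 v               ∎
  where open ≡-Reasoning

decreasingOnBlocks-++ : ∀ {n m} isStart isStart′ (x : Vec ℕ n) (y : Vec ℕ m) → (∀ j → at x (suc j) ≤ at x j) →
                        (∀ k → isStart (n + k) ≡ isStart′ k) → isStart′ 0 ≡ true →
                        DecreasingOnBlocks isStart′ y → DecreasingOnBlocks isStart (x ++ y)
decreasingOnBlocks-++ isStart isStart′ [] y _ shift _ decy i i+1<m inner = decy i i+1<m (trans (sym (shift (suc i))) inner)
decreasingOnBlocks-++ isStart isStart′ (x₀ ∷ []) y _ shift start _ zero _ inner =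
  contradiction (trans (sym inner) (trans (shift 0) start)) λ ()
decreasingOnBlocks-++ isStart isStart′ (x₀ ∷ x₁ ∷ x) y decx _ _ _ zero _ _ = decx 0
decreasingOnBlocks-++ isStart isStart′ (x₀ ∷ x) y decx shift start decy (suc i) (s≤s i+1<n) inner =
  decreasingOnBlocks-++ (isStart ∘ suc) isStart′ x y (decx ∘ suc) shift start decy i i+1<n inner

agreeOnBlocks-++ : ∀ {n m} isStart isStart′ (x x′ : Vec ℕ n) (y y′ : Vec ℕ m) →
                   (∀ v → excess x 0 v ≡ excess x′ 0 v) → (∀ k → suc k < n → isStart (suc k) ≡ false) →
                   (∀ k → isStart (n + k) ≡ isStart′ k) → AgreeOnBlocks isStart′ y y′ → AgreeOnBlocks isStart (x ++ y) (x′ ++ y′)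
agreeOnBlocks-++ isStart isStart′ x x′ y y′ agreex _ _ agreey zero _ v = begin
  excess (x ++ y) 0 v               ≡⟨ excess-++ x y v ⟩
  excess x 0 v + excess y 0 v       ≡⟨ cong₂ _+_ (agreex v) (agreey 0 (inj₁ refl) v) ⟩
  excess x′ 0 v + excess y′ 0 v     ≡⟨ excess-++ x′ y′ v ⟨
  excess (x′ ++ y′) 0 v             ∎
  where open ≡-Reasoning
agreeOnBlocks-++ {n} isStart isStart′ x x′ y y′ _ interior shift agreey (suc k) (inj₂ s) v with <-≤-connex (suc k) n
... | inj₁ k+1<n = contradiction (trans (sym s) (interior k k+1<n)) λ ()
... | inj₂ n≤k+1 with m≤n⇒∃[o]m+o≡n n≤k+1
...   | j , n+j≡k+1 = begin
  excess (x ++ y) (suc k) v         ≡⟨ cong (λ t → excess (x ++ y) t v) n+j≡k+1 ⟨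
  excess (x ++ y) (n + j) v         ≡⟨ excess-++ʳ x y j v ⟩
  excess y j v                      ≡⟨ agreey j (inj₂ (trans (sym (shift j)) (subst (λ t → isStart t ≡ true) (sym n+j≡k+1) s)))
                                              v ⟩
  excess y′ j v                     ≡⟨ excess-++ʳ x′ y′ j v ⟨
  excess (x′ ++ y′) (n + j) v       ≡⟨ cong (λ t → excess (x′ ++ y′) t v) n+j≡k+1 ⟩
  excess (x′ ++ y′) (suc k) v       ∎
  where open ≡-Reasoning

decreasingOnBlocks-concat : ∀ {r} (ns : Vec ℕ r) (f : ∀ i → Vec ℕ (lookup ns i)) →
                            (∀ i j → at (f i) (suc j) ≤ at (f i) j) → DecreasingOnBlocks (blockStart ns) (concatB ns f)
decreasingOnBlocks-concat [] f _ i ()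
decreasingOnBlocks-concat (n ∷ ns) f dec =
  decreasingOnBlocks-++ (blockStart (n ∷ ns)) (blockStart ns) (f zero) (concatB ns (f ∘ suc)) (dec zero)
    (blockStart-shift n ns) (blockStart-zero ns) (decreasingOnBlocks-concat ns (f ∘ suc) (dec ∘ suc))

agreeOnBlocks-concat : ∀ {r} (ns : Vec ℕ r) (f g : ∀ i → Vec ℕ (lookup ns i)) →
                       (∀ i v → excess (f i) 0 v ≡ excess (g i) 0 v) →
                       AgreeOnBlocks (blockStart ns) (concatB ns f) (concatB ns g)
agreeOnBlocks-concat [] f g _ k _ v = refl
agreeOnBlocks-concat (n ∷ ns) f g agree =
  agreeOnBlocks-++ (blockStart (n ∷ ns)) (blockStart ns) (f zero) (g zero) (concatB ns (f ∘ suc)) (concatB ns (g ∘ suc))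
    (agree zero) (blockStart-interior n ns) (blockStart-shift n ns)
    (agreeOnBlocks-concat ns (f ∘ suc) (g ∘ suc) (agree ∘ suc))

-- Coefficients of key polynomials

lookup≡at : ∀ {n} (xs : Vec ℕ n) (j : Fin n) → lookup xs j ≡ at xs (toℕ j)
lookup≡at (x ∷ xs) zero = refl
lookup≡at (x ∷ xs) (suc j) = lookup≡at xs j

swapAdj≡swapAt : ∀ {m} (i : Fin m) (α : Vec ℕ (suc m)) → swapAdj i α ≡ swapAt (toℕ i) α
swapAdj≡swapAt zero (x ∷ y ∷ xs) = refl
swapAdj≡swapAt (suc i) (x ∷ xs) = cong (x ∷_) (swapAdj≡swapAt i xs)

lookup-setPair₁ : ∀ {m} (i : Fin m) (c : Vec ℕ (suc m)) u z → lookup (setPair (toℕ i) c u z) (inject₁ i) ≡ u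
lookup-setPair₁ zero (x ∷ y ∷ xs) u z = refl
lookup-setPair₁ (suc i) (x ∷ xs) u z = lookup-setPair₁ i xs u z

lookup-setPair₂ : ∀ {m} (i : Fin m) (c : Vec ℕ (suc m)) u z → lookup (setPair (toℕ i) c u z) (suc i) ≡ z
lookup-setPair₂ zero (x ∷ y ∷ xs) u z = refl
lookup-setPair₂ (suc i) (x ∷ xs) u z = lookup-setPair₂ i xs u z

setPair-update₁ : ∀ {m} (i : Fin m) (c : Vec ℕ (suc m)) u z w →
                  setPair (toℕ i) c u z [ inject₁ i ]≔ w ≡ setPair (toℕ i) c w z
setPair-update₁ zero (x ∷ y ∷ xs) u z w = refl
setPair-update₁ (suc i) (x ∷ xs) u z w = cong (x ∷_) (setPair-update₁ i xs u z w)

setPair-update₂ : ∀ {m} (i : Fin m) (c : Vec ℕ (suc m)) u z w →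
                  setPair (toℕ i) c u z [ suc i ]≔ w ≡ setPair (toℕ i) c u w
setPair-update₂ zero (x ∷ y ∷ xs) u z w = refl
setPair-update₂ (suc i) (x ∷ xs) u z w = cong (x ∷_) (setPair-update₂ i xs u z w)

swapAdj-setPair : ∀ {m} (i : Fin m) (c : Vec ℕ (suc m)) u z → swapAdj i (setPair (toℕ i) c u z) ≡ setPair (toℕ i) c z u
swapAdj-setPair zero (x ∷ y ∷ xs) u z = refl
swapAdj-setPair (suc i) (x ∷ xs) u z = cong (x ∷_) (swapAdj-setPair i xs u z)

mulX-suc : ∀ {n} (j : Fin n) f a {k} → lookup a j ≡ suc k → mulX j f a ≡ f (a [ j ]≔ k)
mulX-suc j f a eq with lookup a j
mulX-suc j f a refl | .(suc _) = refl

mulX-zero : ∀ {n} (j : Fin n) f a → lookup a j ≡ 0 → mulX j f a ≡ 0ℤ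
mulX-zero j f a eq with lookup a j
mulX-zero j f a refl | .0 = refl

toℕ-preimage : ∀ {m i} → i < m → ∃ λ (j : Fin m) → toℕ j ≡ i
toℕ-preimage i<m = fromℕ< i<m , toℕ-fromℕ< i<m

module KeyCoefficients (K : KeyFamily) (isK : IsKeyFamily K) where
  open IsKeyFamily isK

  -- key-step read off at the points where (x_i, x_{i+1}) is (u + 1, d + 1), resp. (u + 1, 0)
  private
    module _ {m} (β : Vec ℕ (suc m)) (i : Fin m) (desc : lookup β (suc i) < lookup β (inject₁ i)) (c : Vec ℕ (suc m)) where

      P : ℕ → ℕ → Vec ℕ (suc m)
      P = setPair (toℕ i) c

      K′ : Poly (suc m)
      K′ = K (swapAdj i β)

      shiftᵢ : ∀ F u z → mulX (inject₁ i) F (P (suc u) z) ≡ F (P u z)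
      shiftᵢ F u z = trans (mulX-suc (inject₁ i) F (P (suc u) z) (lookup-setPair₁ i c _ _)) (cong F (setPair-update₁ i c _ _ u))

      shiftᵢ₊₁ : ∀ F u z → mulX (suc i) F (P u (suc z)) ≡ F (P u z)
      shiftᵢ₊₁ F u z = trans (mulX-suc (suc i) F (P u (suc z)) (lookup-setPair₂ i c _ _)) (cong F (setPair-update₂ i c _ _ z))

      vanishᵢ₊₁ : ∀ F u → mulX (suc i) F (P u 0) ≡ 0ℤ
      vanishᵢ₊₁ F u = mulX-zero (suc i) F (P u 0) (lookup-setPair₂ i c u 0)

      interior : ∀ u d → K′ (P u (suc d)) -ℤ K′ (P (suc u) d) ≡ K β (P u (suc d)) -ℤ K β (P d (suc u))
      interior u d = begin
        K′ (P u (suc d)) -ℤ K′ (P (suc u) d)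
          ≡⟨ cong₂ _-ℤ_ (shiftᵢ K′ u _) (shiftᵢ₊₁ K′ _ d) ⟨
        mulX (inject₁ i) K′ a -ℤ mulX (suc i) K′ a
          ≡⟨ key-step β i desc a ⟩
        mulX (inject₁ i) (K β) a -ℤ mulX (suc i) (sAct i (K β)) a
          ≡⟨ cong₂ _-ℤ_ (shiftᵢ (K β) u _) (shiftᵢ₊₁ (sAct i (K β)) _ d) ⟩
        K β (P u (suc d)) -ℤ K β (swapAdj i (P (suc u) d))
          ≡⟨ cong (λ x → K β (P u (suc d)) -ℤ K β x) (swapAdj-setPair i c (suc u) d) ⟩
        K β (P u (suc d)) -ℤ K β (P d (suc u))
          ∎
        where
        open ≡-Reasoning
        a = P (suc u) (suc d)

      edge : ∀ u → K′ (P u 0) ≡ K β (P u 0)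
      edge u = begin
        K′ (P u 0)
          ≡⟨ ℤₚ.+-identityʳ _ ⟨
        K′ (P u 0) -ℤ 0ℤ
          ≡⟨ cong₂ _-ℤ_ (shiftᵢ K′ u 0) (vanishᵢ₊₁ K′ _) ⟨
        mulX (inject₁ i) K′ a -ℤ mulX (suc i) K′ a
          ≡⟨ key-step β i desc a ⟩
        mulX (inject₁ i) (K β) a -ℤ mulX (suc i) (sAct i (K β)) a
          ≡⟨ cong₂ _-ℤ_ (shiftᵢ (K β) u 0) (vanishᵢ₊₁ (sAct i (K β)) _) ⟩
        K β (P u 0) -ℤ 0ℤ
          ≡⟨ ℤₚ.+-identityʳ _ ⟩
        K β (P u 0)
          ∎
        where
        open ≡-Reasoning
        a = P (suc u) 0

    descent-lookup : ∀ {m} (β : Vec ℕ (suc m)) (j : Fin m) → at β (suc (toℕ j)) < at β (toℕ j) →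
                     lookup β (suc j) < lookup β (inject₁ j)
    descent-lookup β j = subst₂ _<_ (sym (lookup≡at β (suc j)))
                                    (sym (trans (lookup≡at β (inject₁ j)) (cong (at β) (toℕ-inject₁ j))))

  key-step-interior : ∀ {n} (β : Vec ℕ n) i → suc i < n → at β (suc i) < at β i → ∀ c u d →
    K (swapAt i β) (setPair i c u (suc d)) -ℤ K (swapAt i β) (setPair i c (suc u) d)
    ≡ K β (setPair i c u (suc d)) -ℤ K β (setPair i c d (suc u))
  key-step-interior {suc m} β i (s≤s i<m) desc c with toℕ-preimage i<m
  ... | j , refl rewrite sym (swapAdj≡swapAt j β) = interior β j (descent-lookup β j desc) c

  key-step-edge : ∀ {n} (β : Vec ℕ n) i → suc i < n → at β (suc i) < at β i → ∀ c u →
    K (swapAt i β) (setPair i c u 0) ≡ K β (setPair i c u 0)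
  key-step-edge {suc m} β i (s≤s i<m) desc c with toℕ-preimage i<m
  ... | j , refl rewrite sym (swapAdj≡swapAt j β) = edge β j (descent-lookup β j desc) c

  module _ {n} (β : Vec ℕ n) (i : ℕ) (i<n : suc i < n) (desc : at β (suc i) < at β i) (c : Vec ℕ n) where

    private
      a = at c i
      b = at c (suc i)
      s = a + b

      -- the coefficients of K_{s_i β} and K_β along the line through c where x_i + x_{i+1} = s
      G L : ℕ → ℤ
      G w = K (swapAt i β) (rebalance i c w)
      L w = K β (rebalance i c w)

      top : G s ≡ L s
      top rewrite n∸n≡0 s = key-step-edge β i i<n desc c s

      step : ∀ u d → suc (u + d) ≡ s → G u -ℤ G (suc u) ≡ L u -ℤ L d
      step u d e rewrite sym e | m+n∸m≡n u d | m+n∸n≡m (suc u) d | sym (+-suc u d) | m+n∸m≡n u (suc d) =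
        key-step-interior β i i<n desc c u d

    coeff-swapAt : (∀ w → w ≤ a + b → Outside a b w → w ≢ a ⊔ b → K β (rebalance i c w) ≡ 0ℤ) →
                   K (swapAt i β) c ≡ K β (rebalance i c (a ⊔ b))
    coeff-swapAt zeros = begin
      K (swapAt i β) c                                           ≡⟨ cong (K (swapAt i β)) (rebalance-at i c) ⟨
      G a                                                        ≡⟨ telescope G L s top step a b refl ⟩
      prefixSum L (suc s) -ℤ (prefixSum L a +ℤ prefixSum L b)    ≡⟨ prefixSum-pair-⊔ L a b zeros ⟩
      L (a ⊔ b)                                                  ∎
      where open ≡-Reasoning

    coeff-swapAt-witness : K (swapAt i β) c ≢ 0ℤ →
                           ∃ λ w → w ≤ a + b × Outside a b w × K β (rebalance i c w) ≢ 0ℤ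
    coeff-swapAt-witness K≢0 with anyUpTo? (λ w → outside? a b w ×-dec ¬? (L w ℤ.≟ 0ℤ)) (suc s)
    ... | yes (w , s≤s w≤s , out , Lw≢0) = w , w≤s , out , Lw≢0
    ... | no none = contradiction vanishing K≢0
      where
      zeros : ∀ w → w ≤ s → Outside a b w → L w ≡ 0ℤ
      zeros w w≤s out = decidable-stable (L w ℤ.≟ 0ℤ) λ Lw≢0 → none (w , s≤s w≤s , out , Lw≢0)
      vanishing : K (swapAt i β) c ≡ 0ℤ
      vanishing = trans (coeff-swapAt λ w w≤s out _ → zeros w w≤s out) (zeros (a ⊔ b) (m⊔n≤m+n a b) (outside-⊔ a b))

  record Triangular {n} (α : Vec ℕ n) : Set where
    field
      diagonal : K α α ≡ 1ℤ
      support : ∀ b → K α b ≢ 0ℤ → b ⊴ α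

  triangular-decreasing : ∀ {n} (α : Vec ℕ n) → WeaklyDecreasing α → Triangular α
  triangular-decreasing α dec = record
    { diagonal = trans (key-dominant α dec α) (monomial-diagonal α)
    ; support = λ b K≢0 → subst (_⊴ α) (sym (monomial-support α b (K≢0 ∘ trans (key-dominant α dec b)))) (⊴-refl α)
    }
    where
    monomial-diagonal : ∀ {n} (α : Vec ℕ n) → monomial α α ≡ 1ℤ
    monomial-diagonal α with ≡-dec ℕ._≟_ α α
    ... | yes _ = refl
    ... | no α≢α = contradiction refl α≢α
    monomial-support : ∀ {n} (α b : Vec ℕ n) → monomial α b ≢ 0ℤ → b ≡ α
    monomial-support α b m≢0 with ≡-dec ℕ._≟_ b α
    ... | yes b≡α = b≡α
    ... | no _ = contradiction refl m≢0

  module _ {n} (β : Vec ℕ n) (i : ℕ) (i<n : suc i < n) (desc : at β (suc i) < at β i)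
           (maximal : ∀ k → i ≤ k → at β k ≤ at β i) (tri : Triangular β) where

    open Triangular tri

    private
      p = at β i
      q = at β (suc i)
      α = swapAt i β

      αᵢ : at α i ≡ q
      αᵢ = at-setPair₁ i β q p i<n

      αᵢ₊₁ : at α (suc i) ≡ p
      αᵢ₊₁ = at-setPair₂ i β q p i<n

      pair-bounded : ∀ x → K β x ≢ 0ℤ → at x i ≤ p × at x (suc i) ≤ p
      pair-bounded x K≢0 = bounded i ≤-refl , bounded (suc i) (n≤1+n i)
        where bounded = ⊴-bounded (support x K≢0) maximal

    diagonal-swapAt : K α α ≡ 1ℤ
    diagonal-swapAt = begin
      K α α                                          ≡⟨ coeff-swapAt β i i<n desc α zeros ⟩
      K β (rebalance i α (at α i ⊔ at α (suc i)))    ≡⟨ cong (K β) rebalance-max ⟩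
      K β β                                          ≡⟨ diagonal ⟩
      1ℤ                                             ∎
      where
      open ≡-Reasoning
      q≤p : at α i ≤ at α (suc i)
      q≤p = subst₂ _≤_ (sym αᵢ) (sym αᵢ₊₁) (<⇒≤ desc)
      rebalance-max : rebalance i α (at α i ⊔ at α (suc i)) ≡ β
      rebalance-max rewrite m≤n⇒m⊔n≡n q≤p | m+n∸n≡m (at α i) (at α (suc i)) =
        trans (cong₂ (setPair i α) αᵢ₊₁ αᵢ) (trans (setPair-setPair i β q p p q) (setPair-at i β))
      zeros : ∀ w → w ≤ at α i + at α (suc i) → Outside (at α i) (at α (suc i)) w → w ≢ at α i ⊔ at α (suc i) →
              K β (rebalance i α w) ≡ 0ℤ
      zeros w _ out w≢max = decidable-stable (K β _ ℤ.≟ 0ℤ) λ K≢0 →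
        let (xᵢ≤p , xᵢ₊₁≤p) = pair-bounded _ K≢0 in
        w≢max (trans (outside-≤-max q≤p out (subst₂ _≤_ (at-setPair₁ i α w _ i<n) (sym αᵢ₊₁) xᵢ≤p)
                                             (subst₂ _≤_ (at-setPair₂ i α w _ i<n) (sym αᵢ₊₁) xᵢ₊₁≤p))
                     (sym (m≤n⇒m⊔n≡n q≤p)))

    support-swapAt : ∀ c → K α c ≢ 0ℤ → c ⊴ α
    support-swapAt c K≢0 with coeff-swapAt-witness β i i<n desc c K≢0
    ... | w , w≤s , out , Kx≢0 = dominated excess-c≤α
      where
      x = rebalance i c w
      x⊴β = support x Kx≢0

      cᵢ₊₁≤p : at c (suc i) ≤ p
      cᵢ₊₁≤p = let (xᵢ≤p , xᵢ₊₁≤p) = pair-bounded x Kx≢0 in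
        proj₂ (outside-≤ out (subst (_≤ p) (at-setPair₁ i c w _ i<n) xᵢ≤p)
                             (subst (_≤ p) (at-setPair₂ i c w _ i<n) xᵢ₊₁≤p))

      beyond-pair : ∀ k v → suc (suc i) ≤ k → excess c k v ≤ excess α k v
      beyond-pair k v i+2≤k = begin
        excess c k v   ≡⟨ excess-setPair-hi i c _ _ v i+2≤k ⟨
        excess x k v   ≤⟨ excess-≤ x⊴β k v ⟩
        excess β k v   ≡⟨ excess-swapAt-hi i β v i+2≤k ⟨
        excess α k v   ∎
        where open ≤-Reasoning

      excess-c≤α : ∀ k v → excess c k v ≤ excess α k v
      excess-c≤α k v with <-cmp k (suc i)
      ... | tri< k<i+1 _ _ = begin
        excess c k v   ≤⟨ excess-≤-rebalance i c i<n out w≤s v (≤-pred k<i+1) ⟩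
        excess x k v   ≤⟨ excess-≤ x⊴β k v ⟩
        excess β k v   ≡⟨ excess-swapAt-lo i β v (≤-pred k<i+1) i<n ⟨
        excess α k v   ∎
        where open ≤-Reasoning
      ... | tri≈ _ refl _ = begin
        excess c (suc i) v                              ≡⟨ excess-at c (suc i) v i<n ⟩
        (at c (suc i) ∸ v) + excess c (suc (suc i)) v   ≤⟨ +-mono-≤ (∸-monoˡ-≤ v cᵢ₊₁≤p) (beyond-pair _ v ≤-refl) ⟩
        (p ∸ v) + excess α (suc (suc i)) v              ≡⟨ cong (λ t → (t ∸ v) + excess α (suc (suc i)) v) αᵢ₊₁ ⟨
        (at α (suc i) ∸ v) + excess α (suc (suc i)) v   ≡⟨ excess-at α (suc i) v i<n ⟨
        excess α (suc i) v                              ∎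
        where open ≤-Reasoning
      ... | tri> _ _ i+1<k = beyond-pair k v i+1<k

    triangular-swapAt : Triangular α
    triangular-swapAt = record { diagonal = diagonal-swapAt ; support = support-swapAt }

  triangular : ∀ {n} (α : Vec ℕ n) → Triangular α
  triangular α = go α (<-wellFounded (moment α))
    where
    go : ∀ {n} (α : Vec ℕ n) → Acc _<_ (moment α) → Triangular α
    go α (acc smaller) with weaklyDecreasing⊎lastAscent α
    ... | inj₁ dec = triangular-decreasing α dec
    ... | inj₂ (i , i<n , asc , after) = subst Triangular (swapAt-involutive i α)
          (triangular-swapAt β i i<n desc maximal (go β (smaller (moment-swapAt-< i α i<n asc))))
      where
      β = swapAt i α
      βᵢ : at β i ≡ at α (suc i)
      βᵢ = at-setPair₁ i α _ _ i<n
      desc : at β (suc i) < at β i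
      desc = subst₂ _<_ (sym (at-setPair₂ i α _ _ i<n)) (sym βᵢ) asc
      maximal : ∀ k → i ≤ k → at β k ≤ at β i
      maximal k i≤k with m≤n⇒m<n∨m≡n i≤k
      ... | inj₂ refl = ≤-refl
      ... | inj₁ i<k with m≤n⇒m<n∨m≡n i<k
      ...   | inj₂ refl = <⇒≤ desc
      ...   | inj₁ i+1<k = subst₂ _≤_ (sym (at-setPair-other i α _ _ k (>⇒≢ i<k) (>⇒≢ i+1<k))) (sym βᵢ) (after k i+1<k)

  coeff-agreeOnBlocks : ∀ {n} isStart (δ : Vec ℕ n) → DecreasingOnBlocks isStart δ →
                        ∀ w → AgreeOnBlocks isStart w δ → K w δ ≡ 1ℤ
  coeff-agreeOnBlocks isStart δ decδ w₀ agree₀ = go w₀ (<-wellFounded (moment w₀)) agree₀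
    where
    go : ∀ w → Acc _<_ (moment w) → AgreeOnBlocks isStart w δ → K w δ ≡ 1ℤ
    go w (acc smaller) agree with decreasingOnBlocks⊎innerAscent isStart w
    ... | inj₁ decw = subst (λ x → K x δ ≡ 1ℤ) (sym (agreeOnBlocks⇒≡ isStart w δ decw decδ agree))
                            (Triangular.diagonal (triangular δ))
    ... | inj₂ (i , i+1<n , inner , asc) = begin
      K w δ                                  ≡⟨ cong (λ x → K x δ) (swapAt-involutive i w) ⟨
      K (swapAt i w′) δ                      ≡⟨ coeff-swapAt w′ i i+1<n desc δ zeros ⟩
      K w′ (rebalance i δ (a ⊔ b))           ≡⟨ cong (λ t → K w′ (rebalance i δ t)) (m≥n⇒m⊔n≡m b≤a) ⟩
      K w′ (rebalance i δ a)                 ≡⟨ cong (K w′) (rebalance-at i δ) ⟩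
      K w′ δ                                 ≡⟨ go w′ (smaller (moment-swapAt-< i w i+1<n asc)) agree′ ⟩
      1ℤ                                     ∎
      where
      open ≡-Reasoning
      w′ = swapAt i w
      a = at δ i
      b = at δ (suc i)
      b≤a : b ≤ a
      b≤a = decδ i i+1<n inner
      desc : at w′ (suc i) < at w′ i
      desc = subst₂ _<_ (sym (at-setPair₂ i w _ _ i+1<n)) (sym (at-setPair₁ i w _ _ i+1<n)) asc
      agree′ : AgreeOnBlocks isStart w′ δ
      agree′ = agreeOnBlocks-swapAt isStart w δ i i+1<n inner agree
      -- the other points x of the line through δ have excess x 0 a > excess δ 0 a = excess w′ 0 a
      zeros : ∀ u → u ≤ a + b → Outside a b u → u ≢ a ⊔ b → K w′ (rebalance i δ u) ≡ 0ℤ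
      zeros u _ out u≢max = decidable-stable (K w′ _ ℤ.≟ 0ℤ) λ K≢0 →
        <⇒≱ (excess-<-rebalance i δ i+1<n out u≢a b≤a)
            (≤-trans (excess-≤ (Triangular.support (triangular w′) _ K≢0) 0 a) (≤-reflexive (agree′ 0 (inj₁ refl) a)))
        where
        u≢a : u ≢ a
        u≢a = subst (u ≢_) (m≥n⇒m⊔n≡m b≤a) u≢max

-- Partitions

listExcess : List ℕ → ℕ → ℕ
listExcess μ v = sum (List.map (_∸ v) μ)

listExcess-bounded : ∀ {l v} → All (_≤ v) l → listExcess l v ≡ 0
listExcess-bounded [] = refl
listExcess-bounded (x≤v ∷ l≤v) = cong₂ _+_ (m≤n⇒m∸n≡0 x≤v) (listExcess-bounded l≤v)

bounded-by-head : ∀ {x l} → Linked _≥_ (x ∷ l) → All (_≤ x) (x ∷ l)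
bounded-by-head = Linked⇒All (λ p q → ≤-trans q p) ≤-refl

excess-padTo : ∀ n (l : List ℕ) v → length l ≤ n → excess (padTo n l) 0 v ≡ listExcess l v
excess-padTo zero [] v _ = refl
excess-padTo (suc n) [] v _ = cong₂ _+_ (0∸n≡0 v) (excess-padTo n [] v z≤n)
excess-padTo (suc n) (x ∷ l) v (s≤s l≤n) = cong ((x ∸ v) +_) (excess-padTo n l v l≤n)

padTo-≤ : ∀ n {l x} → All (_≤ x) l → ∀ j → at (padTo n l) j ≤ x
padTo-≤ zero _ j = z≤n
padTo-≤ (suc n) {[]} _ zero = z≤n
padTo-≤ (suc n) {[]} _ (suc j) = padTo-≤ n [] j
padTo-≤ (suc n) {y ∷ l} (y≤x ∷ _) zero = y≤x
padTo-≤ (suc n) {y ∷ l} (_ ∷ l≤x) (suc j) = padTo-≤ n l≤x j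

padTo-decreasing : ∀ n {l} → Linked _≥_ l → ∀ j → at (padTo n l) (suc j) ≤ at (padTo n l) j
padTo-decreasing zero _ j = z≤n
padTo-decreasing (suc n) {[]} _ zero = padTo-≤ n [] 0
padTo-decreasing (suc n) {[]} _ (suc j) = padTo-decreasing n [] j
padTo-decreasing (suc n) {x ∷ l} dec zero = padTo-≤ n (All.tail (bounded-by-head dec)) 0
padTo-decreasing (suc n) {x ∷ l} dec (suc j) = padTo-decreasing n (Linked.tail dec) j

listExcess-≤⇒≡⊎<L : ∀ {μ λ′} → IsPartition μ → IsPartition λ′ →
                    (∀ v → listExcess μ v ≤ listExcess λ′ v) → μ ≡ λ′ ⊎ μ <L λ′
listExcess-≤⇒≡⊎<L {[]} {[]} _ _ _ = inj₁ refl
listExcess-≤⇒≡⊎<L {[]} {x ∷ _} _ (_ , 0<x ∷ _) _ = inj₂ (inj₁ 0<x)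
listExcess-≤⇒≡⊎<L {y ∷ _} {[]} (_ , 0<y ∷ _) _ ≤excess = contradiction (≤-trans (m≤m+n y _) (≤excess 0)) (<⇒≱ 0<y)
listExcess-≤⇒≡⊎<L {y ∷ μ} {x ∷ λ′} (decμ , posμ) (decλ , posλ) ≤excess with <-cmp y x
... | tri< y<x _ _ = inj₂ (inj₁ y<x)
... | tri> _ _ x<y =
  contradiction (≤-trans (m≤m+n (y ∸ x) _) (≤excess x)) (<⇒≱ (subst (_< y ∸ x) (sym λ-excess) (m<n⇒0<n∸m x<y)))
  where
  λ-excess : listExcess (x ∷ λ′) x ≡ 0
  λ-excess = listExcess-bounded (bounded-by-head decλ)
... | tri≈ _ refl _ with listExcess-≤⇒≡⊎<L (Linked.tail decμ , All.tail posμ) (Linked.tail decλ , All.tail posλ)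
                                          (λ v → +-cancelˡ-≤ (y ∸ v) _ _ (≤excess v))
...   | inj₁ refl = inj₁ refl
...   | inj₂ μ<λ = inj₂ (inj₂ (refl , μ<λ))

Fits : ∀ {r} → Vec ℕ r → Vec Partition r → Set
Fits ns λs = ∀ i → length (parts (lookup λs i)) ≤ lookup ns i

totalLength : ∀ {r} → Vec Partition r → ℕ
totalLength [] = 0
totalLength (λ₀ ∷ λs) = length (parts λ₀) + totalLength λs

length≤totalLength : ∀ {r} (λs : Vec Partition r) i → length (parts (lookup λs i)) ≤ totalLength λs
length≤totalLength (λ₀ ∷ λs) zero = m≤m+n _ _
length≤totalLength (λ₀ ∷ λs) (suc i) = ≤-trans (length≤totalLength λs i) (m≤n+m _ _)

muVec-cong : ∀ {r} (ns : Vec ℕ r) (μs λs : Vec Partition r) → SameParts μs λs → muVec ns μs ≡ muVec ns λs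
muVec-cong [] [] [] _ = refl
muVec-cong (n ∷ ns) (μ₀ ∷ μs) (λ₀ ∷ λs) same =
  cong₂ Vec._++_ (cong (padTo n) (same zero)) (muVec-cong ns μs λs (same ∘ suc))

gammaVec-agreeOnBlocks : ∀ {r} (ns : Vec ℕ r) (λs : Vec Partition r) →
                         AgreeOnBlocks (blockStart ns) (gammaVec ns λs) (muVec ns λs)
gammaVec-agreeOnBlocks ns λs =
  agreeOnBlocks-concat ns _ _ λ i → excess-reverse (padTo (lookup ns i) (parts (lookup λs i)))

muVec-decreasingOnBlocks : ∀ {r} (ns : Vec ℕ r) (λs : Vec Partition r) → DecreasingOnBlocks (blockStart ns) (muVec ns λs)
muVec-decreasingOnBlocks ns λs =
  decreasingOnBlocks-concat ns _ λ i → padTo-decreasing (lookup ns i) (proj₁ (proj₂ (lookup λs i)))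

⊴⇒sameParts : ∀ {r} (ns : Vec ℕ r) (λs μs : Vec Partition r) → Fits ns λs → Fits ns μs →
              muVec ns μs ⊴ gammaVec ns λs → ¬ (μs ≺ λs) → SameParts μs λs
⊴⇒sameParts [] [] [] _ _ _ _ ()
⊴⇒sameParts (n ∷ ns) (λ₀ ∷ λs) (μ₀ ∷ μs) fitsλ fitsμ μ⊴γ μ⊀λ = same
  where
  m₀ = padTo n (parts μ₀)
  g₀ = reverse (padTo n (parts λ₀))
  tail⊴ : muVec ns μs ⊴ gammaVec ns λs
  tail⊴ = dominated λ k v → subst₂ _≤_ (excess-++ʳ m₀ _ k v) (excess-++ʳ g₀ _ k v) (excess-≤ μ⊴γ (n + k) v)
  tail⊀ : ¬ (μs ≺ λs)
  tail⊀ (k , above , μₖ<λₖ) = μ⊀λ (suc k , (λ { (suc i) (s≤s k<i) → above i k<i }) , μₖ<λₖ)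
  tails : SameParts μs λs
  tails = ⊴⇒sameParts ns λs μs (fitsλ ∘ suc) (fitsμ ∘ suc) tail⊴ tail⊀
  tail-excess : ∀ v → excess (muVec ns μs) 0 v ≡ excess (gammaVec ns λs) 0 v
  tail-excess v = trans (cong (λ x → excess x 0 v) (muVec-cong ns μs λs tails))
                        (sym (gammaVec-agreeOnBlocks ns λs 0 (inj₁ refl) v))
  head-excess-≤ : ∀ v → listExcess (parts μ₀) v ≤ listExcess (parts λ₀) v
  head-excess-≤ v = +-cancelʳ-≤ (excess (gammaVec ns λs) 0 v) _ _ (begin
    listExcess (parts μ₀) v + excess (gammaVec ns λs) 0 v   ≡⟨ cong₂ _+_ (excess-padTo n (parts μ₀) v (fitsμ zero))
                                                                         (tail-excess v) ⟨
    excess m₀ 0 v + excess (muVec ns μs) 0 v                ≡⟨ excess-++ m₀ _ v ⟨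
    excess (muVec (n ∷ ns) (μ₀ ∷ μs)) 0 v                   ≤⟨ excess-≤ μ⊴γ 0 v ⟩
    excess (gammaVec (n ∷ ns) (λ₀ ∷ λs)) 0 v                ≡⟨ excess-++ g₀ _ v ⟩
    excess g₀ 0 v + excess (gammaVec ns λs) 0 v             ≡⟨ cong (_+ _) (trans (excess-reverse (padTo n (parts λ₀)) v)
                                                                                  (excess-padTo n (parts λ₀) v (fitsλ zero))) ⟩
    listExcess (parts λ₀) v + excess (gammaVec ns λs) 0 v   ∎)
    where open ≤-Reasoning
  same : SameParts (μ₀ ∷ μs) (λ₀ ∷ λs)
  same with listExcess-≤⇒≡⊎<L (proj₂ μ₀) (proj₂ λ₀) head-excess-≤
  ... | inj₁ μ₀≡λ₀ = λ { zero → μ₀≡λ₀ ; (suc i) → tails i }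
  ... | inj₂ μ₀<λ₀ = contradiction (zero , (λ { (suc i) _ → tails i }) , μ₀<λ₀) μ⊀λ

mainTheorem8 : (K : KeyFamily) → IsKeyFamily K →
    ∀ (r : ℕ) (λs μs : Vec Partition r) → ¬ (μs ≺ λs) →
    ∃ λ (N : ℕ) → ∀ (ns : Vec ℕ r) → (∀ i → N ≤ lookup ns i) →
      (SameParts μs λs → K (gammaVec ns λs) (muVec ns μs) ≡ 1ℤ)
      × (¬ SameParts μs λs → K (gammaVec ns λs) (muVec ns μs) ≡ 0ℤ)
mainTheorem8 K isK r λs μs μ⊀λ = totalLength λs + totalLength μs , λ ns large → leading ns , lower ns large
  where
  open KeyCoefficients K isK

  leading : ∀ ns → SameParts μs λs → K (gammaVec ns λs) (muVec ns μs) ≡ 1ℤ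
  leading ns same rewrite muVec-cong ns μs λs same =
    coeff-agreeOnBlocks (blockStart ns) (muVec ns λs) (muVec-decreasingOnBlocks ns λs)
                        (gammaVec ns λs) (gammaVec-agreeOnBlocks ns λs)

  lower : ∀ ns → (∀ i → totalLength λs + totalLength μs ≤ lookup ns i) →
          ¬ SameParts μs λs → K (gammaVec ns λs) (muVec ns μs) ≡ 0ℤ
  lower ns large different = decidable-stable (K _ _ ℤ.≟ 0ℤ) λ K≢0 →
    different (⊴⇒sameParts ns λs μs fitsλ fitsμ (Triangular.support (triangular (gammaVec ns λs)) _ K≢0) μ⊀λ)
    where
    fitsλ : Fits ns λs
    fitsλ i = ≤-trans (length≤totalLength λs i) (≤-trans (m≤m+n _ _) (large i))
    fitsμ : Fits ns μs
    fitsμ i = ≤-trans (length≤totalLength μs i) (≤-trans (m≤n+m _ _) (large i))
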